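{- Let $a\geq 4$ and let $k$ be an integer with $2\leq k\leq a/2$. Let $D$ be a strongly connected balanced bipartite digraph of order $2a$ with partite sets $X$ and $Y$ satisfying condition $B_k$. Then: (i) the underlying undirected graph $UG(D)$ is 2-connected; (ii) if $C$ is a directed cycle in $D$ of length $m$ with $2\leq m\leq 2a-2$, then $D$ contains a $C$-bypass.
   Context: Digraphs are finite, without loops and without multiple arcs. A digraph is bipartite with partite sets $X,Y$ if every arc has one end in $X$ and the other in $Y$; it is balanced if $|X|=|Y|$. For a vertex $x$, $d(x)=d^+(x)+d^-(x)$. A pair of distinct vertices $\{x,y\}$ is dominating if there is a vertex $z$ with $xz, yz\in A(D)$. A balanced bipartite digraph of order $2a$ satisfies condition $B_k$ if for every dominating pair $\{x,y\}$ either ($d(x)\geq 2a-k$ and $d(y)\geq a+k$) or ($d(x)\geq a+k$ and $d(y)\geq 2a-k$). $UG(D)$ is the undirected graph on $V(D)$ with an edge $xy$ whenever $xy\in A(D)$ or $yx\in A(D)$. For a cycle $C$, a $C$-bypass is a directed $(x,y)$-path $P$ with $x\neq y$, $|V(P)|\geq 3$ and $V(P)\cap V(C)=\{x,y\}$. -}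

module Defs where

open import Data.Nat using (ℕ; zero; suc; _+_; _*_; _∸_; _≤_)
open import Data.Bool using (Bool; true; false; T; not)
open import Data.Fin using (Fin; zero; suc; inject₁; fromℕ)
open import Data.List using (List; []; _∷_; _++_; [_]; length; filterᵇ; allFin)
open import Data.List.Relation.Unary.All using (All)
open import Data.List.Relation.Unary.Linked using (Linked)
open import Data.List.Relation.Unary.Unique.Propositional using (Unique)
open import Data.List.Membership.Propositional using (_∈_)
open import Data.Product using (Σ; ∃; ∃-syntax; _×_; _,_)
open import Data.Sum using (_⊎_)
open import Relation.Binary.PropositionalEquality using (_≡_; _≢_)
open import Relation.Nullary using (¬_)
open import Data.Unit using (⊤)

record Digraph (n : ℕ) : Set where
  field
    adj    : Fin n → Fin n → Bool
    noLoop : ∀ x → adj x x ≡ false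

module _ {n : ℕ} (D : Digraph n) where
  open Digraph D

  Arc : Fin n → Fin n → Set
  Arc x y = T (adj x y)

  outdeg : Fin n → ℕ
  outdeg x = length (filterᵇ (λ y → adj x y) (allFin n))

  indeg : Fin n → ℕ
  indeg x = length (filterᵇ (λ y → adj y x) (allFin n))

  deg : Fin n → ℕ
  deg x = outdeg x + indeg x

  DirWalk : List (Fin n) → Set
  DirWalk = Linked Arc

  DirPath : List (Fin n) → Set
  DirPath ps = DirWalk ps × Unique ps

  StronglyConnected : Set
  StronglyConnected = ∀ x y → x ≢ y → ∃[ ms ] DirWalk (x ∷ ms ++ [ y ])

  -- bipartite with partite sets X = {v | side v ≡ true}, Y = {v | side v ≡ false}
  Bipartite : (Fin n → Bool) → Set
  Bipartite side = ∀ x y → Arc x y → side x ≡ not (side y)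

  Dominating : Fin n → Fin n → Set
  Dominating x y = x ≢ y × ∃[ z ] (Arc x z × Arc y z)

  UGEdge : Fin n → Fin n → Set
  UGEdge x y = Arc x y ⊎ Arc y x

  UGWalkIn : (Fin n → Set) → Fin n → Fin n → Set
  UGWalkIn P x y = ∃[ ws ] (Linked UGEdge ws × All P ws
                      × ∃[ ms ] ws ≡ x ∷ ms ++ [ y ])

  UGConnected : Set
  UGConnected = ∀ x y → x ≢ y → UGWalkIn (λ _ → ⊤) x y

  UGTwoConnected : Set
  UGTwoConnected = 3 ≤ n × UGConnected
    × (∀ v x y → x ≢ v → y ≢ v → x ≢ y → UGWalkIn (λ w → w ≢ v) x y)

  -- a directed cycle of length m = suc k, given by an injective vertex sequence
  -- c 0 → c 1 → ... → c k → c 0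
  record DirCycle (m : ℕ) : Set where
    field
      k     : ℕ
      len   : m ≡ suc k
      vtx   : Fin (suc k) → Fin n
      inj   : ∀ i j → vtx i ≡ vtx j → i ≡ j
      arcs  : ∀ (i : Fin k) → Arc (vtx (inject₁ i)) (vtx (suc i))
      close : Arc (vtx (fromℕ k)) (vtx zero)

  OnCycle : ∀ {m} → DirCycle m → Fin n → Set
  OnCycle C v = ∃[ i ] DirCycle.vtx C i ≡ v

  Bypass : ∀ {m} → DirCycle m → Set
  Bypass C = ∃[ x ] ∃[ y ] ∃[ ms ]
    ( x ≢ y × ms ≢ [] × DirPath (x ∷ ms ++ [ y ])
    × OnCycle C x × OnCycle C y × All (λ v → ¬ OnCycle C v) ms )

BalancedBipartite : (a : ℕ) → Digraph (2 * a) → (Fin (2 * a) → Bool) → Set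
BalancedBipartite a D side =
  Bipartite D side × length (filterᵇ side (allFin (2 * a))) ≡ a

ConditionB : (a k : ℕ) → Digraph (2 * a) → Set
ConditionB a k D = ∀ x y → Dominating D x y →
    (2 * a ∸ k ≤ deg D x × a + k ≤ deg D y)
  ⊎ (a + k ≤ deg D x × 2 * a ∸ k ≤ deg D y)

module Submission where

-- The only place where the degree condition enters is the *shared neighbour
-- property*: whenever p ≠ p' have a common out-neighbour z, they have a
-- second common neighbour w ≠ z in UG(D).  Indeed B_k gives
-- d(p) + d(p') ≥ 3a, each degree is at most twice the number of
-- UG-neighbours, both neighbourhoods lie in the partite class of z (of size
-- a), so by inclusion–exclusion the two neighbourhoods share at least
-- a/2 ≥ 2 vertices.  This counting argument is developed first.
--
-- Everything else holds in any strongly connected digraph with the shared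
-- neighbour property:
--  * deleting a vertex v: directed walks x ⇝ y and y ⇝ x either avoid v, or
--    both reach in-neighbours p, p' of v avoiding v, which are then joined
--    through their shared neighbour;
--  * bypasses: a vertex r off C (it exists as C is not Hamiltonian) lies on
--    a detour x ⇝ r ⇝ y between cycle vertices; if x = y, the last off-cycle
--    vertex u before x and the cycle predecessor c of x share a neighbour w,
--    and a case analysis on w produces a detour between distinct cycle
--    vertices.  Loop erasure turns any such detour into a bypass.

open import Defs
open import Data.Nat using (ℕ; zero; suc; _+_; _*_; _∸_; _≤_; _<_; z≤n; s≤s; z<s)
open import Data.Nat.Properties
  using (≤-trans; ≤-reflexive; +-mono-≤; +-monoˡ-≤; +-comm; +-assoc; +-identityʳ;
         +-cancelˡ-≡; +-cancelˡ-≤; m∸n+n≡m; m≤m+n; m<m+n; n≤1+n; +-commutativeSemigroup;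
         module ≤-Reasoning)
open import Data.Nat.Tactic.RingSolver using (solve-∀)
open import Algebra.Properties.CommutativeSemigroup +-commutativeSemigroup
  using (interchange)
open import Data.Bool using (Bool; true; false; T; not; _∧_; _∨_)
open import Data.Bool.Properties using (T-∧; T-≡; T-not-≡; not-involutive)
open import Data.Fin using (Fin; zero; suc; fromℕ; inject₁; _≟_)
open import Data.Fin.Properties using (any?; all?; ¬∀⟶∃¬; pigeonhole; <-irrefl)
open import Data.List using (List; []; _∷_; _++_; [_]; length; filterᵇ; allFin)
open import Data.List.Properties using (length-tabulate)
open import Data.List.Membership.Propositional using (_∈_)
open import Data.List.Relation.Unary.Any using (here; there)
open import Data.List.Relation.Unary.All using (All; []; _∷_)
import Data.List.Relation.Unary.All as All
open import Data.List.Relation.Unary.All.Properties using (¬Any⇒All¬; anti-mono)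
import Data.List.Relation.Unary.All.Properties as AllP
open import Data.List.Relation.Unary.AllPairs using ([]; _∷_)
open import Data.List.Relation.Unary.Linked using (Linked; []; [-]; _∷_)
import Data.List.Relation.Unary.Linked as Linked
open import Data.List.Relation.Unary.Unique.Propositional using (Unique)
open import Data.List.Relation.Unary.Unique.Propositional.Properties using (allFin⁺)
open import Data.List.Relation.Binary.Subset.Propositional using (_⊆_)
open import Data.List.Relation.Binary.Subset.Propositional.Properties
  using (xs⊆x∷xs; ∷⁺ʳ; ⊆-trans)
open import Data.Product using (∃-syntax; _×_; _,_; proj₁; proj₂)
open import Data.Sum using (_⊎_; inj₁; inj₂; swap; [_,_]′)
open import Data.Unit using (tt)
open import Data.Empty using (⊥-elim)
open import Function using (_∘_; Equivalence)
open import Relation.Binary.PropositionalEquality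
  using (_≡_; _≢_; refl; sym; trans; cong; cong₂; subst; subst₂; ≢-sym; module ≡-Reasoning)
open import Relation.Nullary using (¬_; Dec; yes; no)
open import Relation.Nullary.Decidable using (isYes; isNo; toWitness; toWitnessFalse)

-- Counting entries of a list that satisfy a Boolean test

ind : Bool → ℕ
ind true  = 1
ind false = 0

count : {A : Set} → (A → Bool) → List A → ℕ
count f xs = length (filterᵇ f xs)

T-∨⁻ : ∀ b c → T (b ∨ c) → T b ⊎ T c
T-∨⁻ true  c t = inj₁ t
T-∨⁻ false c t = inj₂ t

T-∨ˡ : ∀ {b} c → T b → T (b ∨ c)
T-∨ˡ {true} c t = t

T-∨ʳ : ∀ b {c} → T c → T (b ∨ c)
T-∨ʳ true  t = tt
T-∨ʳ false t = t

module _ {A : Set} where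

  count-∷ : ∀ (f : A → Bool) x xs → count f (x ∷ xs) ≡ ind (f x) + count f xs
  count-∷ f x xs with f x
  ... | true  = refl
  ... | false = refl

  count-pointwise : ∀ (f g h k : A → Bool)
    → (∀ x → ind (f x) + ind (g x) ≤ ind (h x) + ind (k x))
    → ∀ xs → count f xs + count g xs ≤ count h xs + count k xs
  count-pointwise f g h k pw [] = z≤n
  count-pointwise f g h k pw (x ∷ xs)
    rewrite count-∷ f x xs | count-∷ g x xs | count-∷ h x xs | count-∷ k x xs
    = subst₂ _≤_ (interchange (ind (f x)) (ind (g x)) (count f xs) (count g xs))
        (interchange (ind (h x)) (ind (k x)) (count h xs) (count k xs))
        (+-mono-≤ (pw x) (count-pointwise f g h k pw xs))

  count-zero : ∀ (f : A → Bool) xs → All (λ y → ¬ T (f y)) xs → count f xs ≡ 0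
  count-zero f [] [] = refl
  count-zero f (y ∷ ys) (¬fy ∷ rest) with f y
  ... | true  = ⊥-elim (¬fy tt)
  ... | false = count-zero f ys rest

  count-none : ∀ xs → count {A} (λ _ → false) xs ≡ 0
  count-none xs = count-zero (λ _ → false) xs (All.universal (λ _ ()) xs)

  count-cover : ∀ (f g h : A → Bool) → (∀ x → T (f x) → T (g x) ⊎ T (h x))
    → ∀ xs → count f xs ≤ count g xs + count h xs
  count-cover f g h cover xs = begin
      count f xs                           ≡⟨ sym (+-identityʳ _) ⟩
      count f xs + 0                       ≡⟨ cong (count f xs +_) (sym (count-none xs)) ⟩
      count f xs + count (λ _ → false) xs  ≤⟨ count-pointwise f _ g h pw xs ⟩
      count g xs + count h xs              ∎
    where
    open ≤-Reasoning
    ind-cover : ∀ b c d → (T b → T c ⊎ T d) → ind b + 0 ≤ ind c + ind d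
    ind-cover false c     d     _ = z≤n
    ind-cover true  true  d     _ = s≤s z≤n
    ind-cover true  false true  _ = s≤s z≤n
    ind-cover true  false false cov with cov tt
    ... | inj₁ ()
    ... | inj₂ ()
    pw : ∀ x → ind (f x) + ind false ≤ ind (g x) + ind (h x)
    pw x = ind-cover (f x) (g x) (h x) (cover x)

  count-mono : ∀ (f g : A → Bool) → (∀ x → T (f x) → T (g x))
    → ∀ xs → count f xs ≤ count g xs
  count-mono f g sub xs =
    ≤-trans (count-cover f g (λ _ → false) (λ x → inj₁ ∘ sub x) xs)
      (≤-reflexive (trans (cong (count g xs +_) (count-none xs)) (+-identityʳ _)))

  count-∨∧ : ∀ (f g : A → Bool) xs
    → count f xs + count g xs ≤ count (λ x → f x ∨ g x) xs + count (λ x → f x ∧ g x) xs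
  count-∨∧ f g = count-pointwise f g _ _ (λ x → ind-∨∧ (f x) (g x))
    where
    ind-∨∧ : ∀ b c → ind b + ind c ≤ ind (b ∨ c) + ind (b ∧ c)
    ind-∨∧ true  true  = s≤s (s≤s z≤n)
    ind-∨∧ true  false = s≤s z≤n
    ind-∨∧ false true  = s≤s z≤n
    ind-∨∧ false false = z≤n

  count-complement : ∀ (f : A → Bool) xs → count f xs + count (λ x → not (f x)) xs ≡ length xs
  count-complement f [] = refl
  count-complement f (x ∷ xs)
    rewrite count-∷ f x xs | count-∷ (λ y → not (f y)) x xs
    = trans (interchange (ind (f x)) (count f xs) (ind (not (f x))) (count (λ y → not (f y)) xs))
        (cong₂ _+_ (ind-not (f x)) (count-complement f xs))
    where
    ind-not : ∀ b → ind b + ind (not b) ≡ 1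
    ind-not true  = refl
    ind-not false = refl

  count-witness : ∀ (f : A → Bool) xs → 1 ≤ count f xs → ∃[ x ] T (f x)
  count-witness f (x ∷ xs) pos with f x in fx
  ... | true  = x , Equivalence.from T-≡ fx
  ... | false = count-witness f xs pos

  count-atMostOne : ∀ (f : A → Bool) z → (∀ x → T (f x) → x ≡ z)
    → ∀ xs → Unique xs → count f xs ≤ 1
  count-atMostOne f z only [] _ = z≤n
  count-atMostOne f z only (x ∷ xs) (x∉xs ∷ unique) with f x in fx
  ... | false = count-atMostOne f z only xs unique
  ... | true  = s≤s (≤-reflexive (count-zero f xs (All.map fails x∉xs)))
    where
    fails : ∀ {y} → x ≢ y → ¬ T (f y)
    fails {y} x≢y fy = x≢y (trans (only x (Equivalence.from T-≡ fx)) (sym (only y fy)))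

-- The shared neighbour property

SharedNeighbour : ∀ {n} → Digraph n → Set
SharedNeighbour {n} D = ∀ (p p' z : Fin n) → p ≢ p' → Arc D p z → Arc D p' z
  → ∃[ w ] w ≢ z × UGEdge D p w × UGEdge D p' w

conditionB⇒degreeSum : ∀ a k (D : Digraph (2 * a)) → k ≤ 2 * a → ConditionB a k D
  → ∀ p p' → Dominating D p p' → 3 * a ≤ deg D p + deg D p'
conditionB⇒degreeSum a k D k≤2a condB p p' dom =
  [ (λ (dp , dp') → subst (_≤ deg D p + deg D p') three-a (+-mono-≤ dp dp'))
  , (λ (dp , dp') → subst (_≤ deg D p + deg D p') (trans (+-comm (a + k) _) three-a) (+-mono-≤ dp dp'))
  ]′ (condB p p' dom)
  where
  open ≡-Reasoning
  three-a : (2 * a ∸ k) + (a + k) ≡ 3 * a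
  three-a = begin
    (2 * a ∸ k) + (a + k)  ≡⟨ cong ((2 * a ∸ k) +_) (+-comm a k) ⟩
    (2 * a ∸ k) + (k + a)  ≡⟨ sym (+-assoc (2 * a ∸ k) k a) ⟩
    (2 * a ∸ k) + k + a    ≡⟨ cong (_+ a) (m∸n+n≡m k≤2a) ⟩
    2 * a + a              ≡⟨ +-comm (2 * a) a ⟩
    3 * a                  ∎

-- The arithmetic core of the counting: if 3 ≤ a and 3a ≤ 2(a + 1 + h),
-- where h counts the common neighbours other than z, then h ≥ 1.
beyond-z : ∀ a h → 3 ≤ a → 3 * a ≤ (a + suc h) + (a + suc h) → 1 ≤ h
beyond-z a (suc h) _ _ = s≤s z≤n
beyond-z a zero 3≤a bound = ⊥-elim (not-3≤2 (≤-trans 3≤a a≤2))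
  where
  three-a : ∀ a → 3 * a ≡ a + a + a
  three-a = solve-∀
  two-a+2 : ∀ a → (a + 1) + (a + 1) ≡ a + a + 2
  two-a+2 = solve-∀
  a≤2 : a ≤ 2
  a≤2 = +-cancelˡ-≤ (a + a) a 2 (subst₂ _≤_ (three-a a) (two-a+2 a) bound)
  not-3≤2 : ¬ (3 ≤ 2)
  not-3≤2 (s≤s (s≤s ()))

module BalancedCounting (a : ℕ) (D : Digraph (2 * a)) (side : Fin (2 * a) → Bool)
  (balanced : BalancedBipartite a D side) where
  open Digraph D

  vertices : List (Fin (2 * a))
  vertices = allFin (2 * a)

  nbr : Fin (2 * a) → Fin (2 * a) → Bool
  nbr p y = adj p y ∨ adj y p

  nbr⇒UGEdge : ∀ p y → T (nbr p y) → UGEdge D p y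
  nbr⇒UGEdge p y = T-∨⁻ (adj p y) (adj y p)

  deg≤2nbr : ∀ p → deg D p ≤ count (nbr p) vertices + count (nbr p) vertices
  deg≤2nbr p = +-mono-≤
    (count-mono (adj p) (nbr p) (λ y → T-∨ˡ (adj y p)) vertices)
    (count-mono (λ y → adj y p) (nbr p) (λ y → T-∨ʳ (adj p y)) vertices)

  nbr-side : ∀ p y → UGEdge D p y → side y ≡ not (side p)
  nbr-side p y (inj₁ py) = trans (sym (not-involutive (side y))) (cong not (sym (proj₁ balanced p y py)))
  nbr-side p y (inj₂ yp) = proj₁ balanced y p yp

  class : Bool → Fin (2 * a) → Bool
  class true  y = side y
  class false y = not (side y)

  class-member : ∀ b y → side y ≡ b → T (class b y)
  class-member true  y e = Equivalence.from T-≡ e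
  class-member false y e = Equivalence.from T-not-≡ e

  class-size : ∀ b → count (class b) vertices ≡ a
  class-size true  = proj₂ balanced
  class-size false = +-cancelˡ-≡ a _ _ (begin
      a + #other                    ≡⟨ cong (_+ #other) (sym (proj₂ balanced)) ⟩
      count side vertices + #other  ≡⟨ count-complement side vertices ⟩
      length vertices               ≡⟨ length-tabulate (λ x → x) ⟩
      2 * a                         ≡⟨ cong (a +_) (+-identityʳ a) ⟩
      a + a                         ∎)
    where
    open ≡-Reasoning
    #other : ℕ
    #other = count (class false) vertices

  -- If a ≥ 3 and every dominating pair has degree sum at least 3a, then D
  -- has the shared neighbour property: N(p) and N(p') lie in the class of
  -- z, so |N(p)| + |N(p')| ≤ a + |N(p) ∩ N(p')|, and the degree bound
  -- forces a common neighbour besides z.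
  sharedNeighbour : 3 ≤ a → (∀ p p' → Dominating D p p' → 3 * a ≤ deg D p + deg D p')
    → SharedNeighbour D
  sharedNeighbour 3≤a degSum p p' z p≢p' pz p'z =
    let w , common = count-witness others vertices (beyond-z a H 3≤a bound)
        pw , rest = Equivalence.to (T-∧ {nbr p w}) common
        p'w , w≢z = Equivalence.to (T-∧ {nbr p' w}) rest
    in  w , toWitnessFalse w≢z , nbr⇒UGEdge p w pw , nbr⇒UGEdge p' w p'w
    where
    both : Fin (2 * a) → Bool
    both y = nbr p y ∧ nbr p' y
    others : Fin (2 * a) → Bool
    others y = nbr p y ∧ (nbr p' y ∧ isNo (y ≟ z))
    N N' H : ℕ
    N  = count (nbr p) vertices
    N' = count (nbr p') vertices
    H  = count others vertices

    in-class-of-z : ∀ q y → Arc D q z → T (nbr q y) → T (class (side z) y)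
    in-class-of-z q y qz qy = class-member (side z) y
      (trans (nbr-side q y (nbr⇒UGEdge q y qy)) (sym (nbr-side q z (inj₁ qz))))

    union≤a : count (λ y → nbr p y ∨ nbr p' y) vertices ≤ a
    union≤a = subst (_ ≤_) (class-size (side z)) (count-mono _ (class (side z)) in-union vertices)
      where
      in-union : ∀ y → T (nbr p y ∨ nbr p' y) → T (class (side z) y)
      in-union y t = [ in-class-of-z p y pz , in-class-of-z p' y p'z ]′ (T-∨⁻ _ _ t)

    both≤1+H : count both vertices ≤ 1 + H
    both≤1+H = ≤-trans (count-cover both (λ y → isYes (y ≟ z)) others split vertices)
      (+-monoˡ-≤ H (count-atMostOne _ z (λ y → toWitness {a? = y ≟ z}) vertices (allFin⁺ (2 * a))))
      where
      split : ∀ y → T (both y) → T (isYes (y ≟ z)) ⊎ T (others y)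
      split y t with y ≟ z
      ... | yes _ = inj₁ tt
      ... | no  _ = let py , p'y = Equivalence.to (T-∧ {nbr p y}) t
                    in  inj₂ (Equivalence.from (T-∧ {nbr p y})
                                (py , Equivalence.from (T-∧ {nbr p' y}) (p'y , tt)))

    bound : 3 * a ≤ (a + suc H) + (a + suc H)
    bound = begin
      3 * a                                ≤⟨ degSum p p' (p≢p' , z , pz , p'z) ⟩
      deg D p + deg D p'                   ≤⟨ +-mono-≤ (deg≤2nbr p) (deg≤2nbr p') ⟩
      (N + N) + (N' + N')                  ≡⟨ interchange N N N' N' ⟩
      (N + N') + (N + N')                  ≤⟨ +-mono-≤ pair≤ pair≤ ⟩
      (a + suc H) + (a + suc H)            ∎
      where
      open ≤-Reasoning
      pair≤ : N + N' ≤ a + suc H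
      pair≤ = ≤-trans (count-∨∧ (nbr p) (nbr p') vertices) (+-mono-≤ union≤a both≤1+H)

-- 2-connectivity of UG(D)

module AvoidingWalks {n : ℕ} (D : Digraph n) (v : Fin n) where

  data Avoiding : Fin n → Fin n → Set where
    stay : ∀ {x} → x ≢ v → Avoiding x x
    edge : ∀ {x w y} → x ≢ v → UGEdge D x w → Avoiding w y → Avoiding x y

  start-avoids : ∀ {x y} → Avoiding x y → x ≢ v
  start-avoids (stay x≢v)     = x≢v
  start-avoids (edge x≢v _ _) = x≢v

  end-avoids : ∀ {x y} → Avoiding x y → y ≢ v
  end-avoids (stay y≢v)      = y≢v
  end-avoids (edge _ _ rest) = end-avoids rest

  infixr 5 _++ᵃ_
  _++ᵃ_ : ∀ {x u y} → Avoiding x u → Avoiding u y → Avoiding x y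
  stay _       ++ᵃ q = q
  edge x≢v e p ++ᵃ q = edge x≢v e (p ++ᵃ q)

  reverse : ∀ {x y} → Avoiding x y → Avoiding y x
  reverse (stay x≢v)     = stay x≢v
  reverse (edge x≢v e p) = reverse p ++ᵃ edge (start-avoids p) (swap e) (stay x≢v)

  toUGWalkIn : ∀ {x y} → Avoiding x y → x ≢ y → UGWalkIn D (λ w → w ≢ v) x y
  toUGWalkIn (stay _) x≢x = ⊥-elim (x≢x refl)
  toUGWalkIn {x} {y} (edge {w = w} x≢v e rest) x≢y with w ≟ y
  ... | yes refl = x ∷ [ w ] , e ∷ [-] , x≢v ∷ end-avoids rest ∷ [] , [] , refl
  ... | no w≢y with toUGWalkIn rest w≢y
  ... | ws , linked , avoid , ms , refl = x ∷ ws , e ∷ linked , x≢v ∷ avoid , w ∷ ms , refl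

  firstVisit : ∀ {y} u ms → u ≢ v → y ≢ v → DirWalk D (u ∷ ms ++ [ y ])
    → Avoiding u y ⊎ ∃[ p ] Avoiding u p × Arc D p v
  firstVisit u []       u≢v y≢v (a ∷ [-]) = inj₁ (edge u≢v (inj₁ a) (stay y≢v))
  firstVisit u (w ∷ ms) u≢v y≢v (a ∷ walk) with w ≟ v
  ... | yes refl = inj₂ (u , stay u≢v , a)
  ... | no w≢v with firstVisit w ms w≢v y≢v walk
  ... | inj₁ q            = inj₁ (edge u≢v (inj₁ a) q)
  ... | inj₂ (p , q , pv) = inj₂ (p , edge u≢v (inj₁ a) q , pv)

twoConnected : ∀ {n} (D : Digraph n) → 3 ≤ n → StronglyConnected D → SharedNeighbour D
  → UGTwoConnected D
twoConnected D 3≤n strong shared = 3≤n , connected , deletion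
  where
  connected : UGConnected D
  connected x y x≢y =
    let ms , walk = strong x y x≢y
    in  x ∷ ms ++ [ y ] , Linked.map inj₁ walk , All.universal (λ _ → tt) _ , ms , refl

  deletion : ∀ v x y → x ≢ v → y ≢ v → x ≢ y → UGWalkIn D (λ w → w ≢ v) x y
  deletion v x y x≢v y≢v x≢y =
    toUGWalkIn (join (firstVisit x _ x≢v y≢v (proj₂ (strong x y x≢y)))
                     (firstVisit y _ y≢v x≢v (proj₂ (strong y x (≢-sym x≢y))))) x≢y
    where
    open AvoidingWalks D v
    -- if both directed walks hit v, join their avoiding parts through the
    -- in-neighbours p, p' of v (and their shared neighbour, if p ≠ p')
    join : Avoiding x y ⊎ ∃[ p ] Avoiding x p × Arc D p v
         → Avoiding y x ⊎ ∃[ p ] Avoiding y p × Arc D p v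
         → Avoiding x y
    join (inj₁ q) _ = q
    join _ (inj₁ q) = reverse q
    join (inj₂ (p , q , pv)) (inj₂ (p' , q' , p'v)) with p ≟ p'
    ... | yes refl = q ++ᵃ reverse q'
    ... | no p≢p' =
      let w , w≢v , pw , p'w = shared p p' v p≢p' pv p'v
      in  q ++ᵃ edge (end-avoids q) pw (edge w≢v (swap p'w) (reverse q'))

-- Paths from walks

module LoopErasure {n : ℕ} (D : Digraph n) where
  open import Data.List.Membership.DecPropositional (_≟_ {n}) using (_∈?_)

  pathFrom : ∀ {x ps y} → x ∈ ps → DirPath D (ps ++ [ y ])
    → ∃[ qs ] qs ⊆ ps × DirPath D (x ∷ qs ++ [ y ])
  pathFrom {ps = x ∷ qs} (here refl) path = qs , xs⊆x∷xs qs x , path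
  pathFrom {ps = p ∷ ps} (there x∈ps) (walk , _ ∷ unique)
    with pathFrom x∈ps (Linked.tail walk , unique)
  ... | qs , qs⊆ps , path = qs , ⊆-trans qs⊆ps (xs⊆x∷xs ps p) , path

  walk⇒path : ∀ x ms y → x ≢ y → DirWalk D (x ∷ ms ++ [ y ])
    → ∃[ ps ] ps ⊆ ms × DirPath D (x ∷ ps ++ [ y ])
  walk⇒path x [] y x≢y walk = [] , (λ ()) , walk , (x≢y ∷ []) ∷ [] ∷ []
  walk⇒path x (h ∷ ms) y x≢y (xh ∷ walk) with h ≟ y
  ... | yes refl = [] , (λ ()) , xh ∷ [-] , (x≢y ∷ []) ∷ [] ∷ []
  ... | no h≢y with walk⇒path h ms y h≢y walk
  ... | ps , ps⊆ms , hpath with x ∈? (h ∷ ps)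
  ...   | yes x∈hps = let qs , qs⊆ , path = pathFrom x∈hps hpath
                      in  qs , ⊆-trans qs⊆ (∷⁺ʳ h ps⊆ms) , path
  ...   | no  x∉hps = h ∷ ps , ∷⁺ʳ h ps⊆ms
                    , (xh ∷ proj₁ hpath , AllP.++⁺ (¬Any⇒All¬ (h ∷ ps) x∉hps) (x≢y ∷ []) ∷ proj₂ hpath)

-- Detours and bypasses of a directed cycle

arc⇒≢ : ∀ {n} (D : Digraph n) {x y} → Arc D x y → x ≢ y
arc⇒≢ D {x} xy refl = subst T (Digraph.noLoop D x) xy

module Detours {n : ℕ} (D : Digraph n) {m : ℕ} (C : DirCycle D m) where
  open DirCycle C
  open LoopErasure D

  Off : Fin n → Set
  Off v = ¬ OnCycle D C v

  onCycle? : ∀ v → Dec (OnCycle D C v)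
  onCycle? v = any? (λ i → vtx i ≟ v)

  off≢on : ∀ {u w} → Off u → OnCycle D C w → u ≢ w
  off≢on offu onw refl = offu onw

  data Via : Fin n → Fin n → Set where
    step : ∀ {s t} → Arc D s t → Via s t
    cons : ∀ {s w t} → Arc D s w → Off w → Via w t → Via s t

  interior : ∀ {s t} → Via s t → List (Fin n)
  interior (step _)              = []
  interior (cons {w = w} _ _ q)  = w ∷ interior q

  via-walk : ∀ {s t} (q : Via s t) → DirWalk D (s ∷ interior q ++ [ t ])
  via-walk (step st)      = st ∷ [-]
  via-walk (cons sw _ q)  = sw ∷ via-walk q

  interior-off : ∀ {s t} (q : Via s t) → All Off (interior q)
  interior-off (step _)        = []
  interior-off (cons _ offw q) = offw ∷ interior-off q

  via-++ : ∀ {s w t} → Via s w → Off w → Via w t → Via s t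
  via-++ (step sw)        offw q = cons sw offw q
  via-++ (cons su offu p) offw q = cons su offu (via-++ p offw q)

  lastInterior : ∀ {s w t} → Via s w → Off w → Via w t → ∃[ u ] Off u × Via s u × Arc D u t
  lastInterior p offw (step wt)        = _ , offw , p , wt
  lastInterior p offw (cons wu offu q) = lastInterior (via-++ p offw (step wu)) offu q

  Detour : Fin n → Fin n → Set
  Detour s t = ∃[ h ] Arc D s h × Off h × Via h t

  through : ∀ {s w t} → Via s w → Off w → Via w t → Detour s t
  through (step sw)        offw q = _ , sw , offw , q
  through (cons sh offh p) offw q = _ , sh , offh , via-++ p offw q

  -- A detour between distinct cycle vertices yields a C-bypass, by loop
  -- erasure after its first step.
  detour⇒bypass : ∀ {s t} → OnCycle D C s → OnCycle D C t → s ≢ t → Detour s t → Bypass D C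
  detour⇒bypass {s} {t} ons ont s≢t (h , sh , offh , q)
    with walk⇒path h (interior q) t (off≢on offh ont) (via-walk q)
  ... | ps , ps⊆ , walk , unique =
    s , t , h ∷ ps , s≢t , (λ ()) , (sh ∷ walk , s∉ ∷ unique) , ons , ont , offhps
    where
    offhps : All Off (h ∷ ps)
    offhps = offh ∷ anti-mono ps⊆ (interior-off q)
    s∉ : All (λ u → ¬ s ≡ u) ((h ∷ ps) ++ [ t ])
    s∉ = AllP.++⁺ (All.map (λ offu → ≢-sym (off≢on offu ons)) offhps) (s≢t ∷ [])

  firstOnCycle : ∀ {c} w ms → OnCycle D C c → DirWalk D (w ∷ ms ++ [ c ])
    → ∃[ y ] OnCycle D C y × Via w y
  firstOnCycle w []       onc (wc ∷ [-]) = _ , onc , step wc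
  firstOnCycle w (u ∷ ms) onc (wu ∷ walk) with onCycle? u
  ... | yes onu  = u , onu , step wu
  ... | no  offu = let y , ony , q = firstOnCycle u ms onc walk
                   in  y , ony , cons wu offu q

  lastOnCycle : ∀ {r} x₀ ms → OnCycle D C x₀ → DirWalk D (x₀ ∷ ms ++ [ r ])
    → ∃[ x ] OnCycle D C x × Via x r
  lastOnCycle x₀ ms onx₀ walk = [ (λ found → found) , (λ q → x₀ , onx₀ , q) ]′ (split x₀ ms walk)
    where
    split : ∀ {r} v ms → DirWalk D (v ∷ ms ++ [ r ]) → (∃[ x ] OnCycle D C x × Via x r) ⊎ Via v r
    split v []       (vr ∷ [-]) = inj₂ (step vr)
    split v (u ∷ ms) (vu ∷ walk) with split u ms walk
    ... | inj₁ found = inj₁ found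
    ... | inj₂ q with onCycle? u
    ...   | yes onu  = inj₁ (u , onu , q)
    ...   | no  offu = inj₂ (cons vu offu q)

  cyclePred : ∀ {x} → OnCycle D C x → ∃[ c ] OnCycle D C c × Arc D c x
  cyclePred (zero  , refl) = vtx (fromℕ k) , (fromℕ k , refl) , close
  cyclePred (suc j , refl) = vtx (inject₁ j) , (inject₁ j , refl) , arcs j

  -- A cycle shorter than n misses some vertex: otherwise the position on C
  -- would inject Fin n into Fin (suc k).
  offCycleVertex : suc k < n → ∃[ r ] Off r
  offCycleVertex short with all? onCycle?
  ... | no notAll = ¬∀⟶∃¬ n (OnCycle D C) onCycle? notAll
  ... | yes onAll with pigeonhole short (λ v → proj₁ (onAll v))
  ... | i , j , i<j , same = ⊥-elim (<-irrefl
          (trans (sym (proj₂ (onAll i))) (trans (cong vtx same) (proj₂ (onAll j)))) i<j)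

bypass : ∀ {n} (D : Digraph n) → StronglyConnected D → SharedNeighbour D
  → ∀ {m} (C : DirCycle D m) → m < n → Bypass D C
bypass {n} D strong shared C m<n =
  detourVia (offCycleVertex (subst (_< n) (DirCycle.len C) m<n))
  where
  open Detours D C
  c₀ : Fin n
  c₀ = DirCycle.vtx C zero
  onc₀ : OnCycle D C c₀
  onc₀ = zero , refl

  enter : ∀ {r} → Off r → ∃[ x ] OnCycle D C x × Via x r
  enter offr = lastOnCycle c₀ _ onc₀ (proj₂ (strong c₀ _ (≢-sym (off≢on offr onc₀))))
  leave : ∀ {r} → Off r → ∃[ y ] OnCycle D C y × Via r y
  leave offr = firstOnCycle _ _ onc₀ (proj₂ (strong _ c₀ (off≢on offr onc₀)))

  -- A detour returning to its start x: the last off-cycle vertex u before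
  -- x and the cycle predecessor c of x share a neighbour w ≠ x, and each
  -- position of w gives a detour between distinct cycle vertices.
  closedDetour : ∀ {x} → OnCycle D C x → Detour x x → Bypass D C
  closedDetour {x} onx (h , xh , offh , hx) with lastInterior (step xh) offh hx | cyclePred onx
  ... | u , offu , xu , ux | c , onc , cx with shared u c x (off≢on offu onc) ux cx
  ... | w , w≢x , uw , cw = around (onCycle? w) uw cw
    where
    c≢x : c ≢ x
    c≢x = arc⇒≢ D cx
    around : Dec (OnCycle D C w) → UGEdge D u w → UGEdge D c w → Bypass D C
    around (yes onw) (inj₁ uw) _ = detour⇒bypass onx onw (≢-sym w≢x) (through xu offu (step uw))
    around (yes onw) (inj₂ wu) _ = detour⇒bypass onw onx w≢x (through (step wu) offu (step ux))
    around (no offw) (inj₂ wu) (inj₁ cw) =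
      detour⇒bypass onc onx c≢x (through (cons cw offw (step wu)) offu (step ux))
    around (no offw) (inj₁ uw) (inj₂ wc) =
      detour⇒bypass onx onc (≢-sym c≢x) (through (via-++ xu offu (step uw)) offw (step wc))
    around (no offw) (inj₁ uw) (inj₁ cw) with leave offw
    ... | y , ony , wy with c ≟ y
    ...   | no c≢y   = detour⇒bypass onc ony c≢y (through (step cw) offw wy)
    ...   | yes refl = detour⇒bypass onx onc (≢-sym c≢x) (through (via-++ xu offu (step uw)) offw wy)
    around (no offw) (inj₂ wu) (inj₂ wc) with enter offw
    ... | y , ony , yw with y ≟ c
    ...   | no y≢c   = detour⇒bypass ony onc y≢c (through yw offw (step wc))
    ...   | yes refl = detour⇒bypass onc onx c≢x (through yw offw (cons wu offu (step ux)))

  detourVia : ∃[ r ] Off r → Bypass D C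
  detourVia (r , offr) with enter offr | leave offr
  ... | x , onx , xr | y , ony , ry with x ≟ y
  ...   | no x≢y   = detour⇒bypass onx ony x≢y (through xr offr ry)
  ...   | yes refl = closedDetour onx (through xr offr ry)

lemma4p3 : (a k : ℕ) → 4 ≤ a → 2 ≤ k → k + k ≤ a
    → (D : Digraph (2 * a)) → (side : Fin (2 * a) → Bool)
    → StronglyConnected D → BalancedBipartite a D side → ConditionB a k D
    → UGTwoConnected D
      × ((m : ℕ) → (C : DirCycle D m) → 2 ≤ m → m + 2 ≤ 2 * a → Bypass D C)
lemma4p3 a k 4≤a _ 2k≤a D side strong balanced condB =
    twoConnected D (≤-trans 3≤a a≤2a) strong shared
  , λ m C _ m+2≤2a → bypass D strong shared C (≤-trans (m<m+n m z<s) m+2≤2a)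
  where
  3≤a : 3 ≤ a
  3≤a = ≤-trans (n≤1+n 3) 4≤a
  a≤2a : a ≤ 2 * a
  a≤2a = m≤m+n a (a + 0)
  -- B_k with k ≤ a/2 gives degree sums ≥ 3a, hence shared neighbours
  shared : SharedNeighbour D
  shared = BalancedCounting.sharedNeighbour a D side balanced 3≤a
    (conditionB⇒degreeSum a k D (≤-trans (m≤m+n k k) (≤-trans 2k≤a a≤2a)) condB)
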